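{- For every integer $n\ge 2$, $|\mathcal{S}_n(1\text{ - }23,\,3\text{ - }21)| = |\mathcal{S}_n(32\text{ - }1,\,12\text{ - }3)| = 2(n-1)$.
   Context: A permutation of $[n]=\{1,\dots,n\}$ is written as a word $\pi=a_1a_2\cdots a_n$. For a permutation $xyz$ of $\{1,2,3\}$: $\pi$ contains the pattern $x\text{ - }yz$ if there are indices $1\le i<j<n$ such that $a_i,a_j,a_{j+1}$ are in the same relative order as $x,y,z$; $\pi$ contains the pattern $xy\text{ - }z$ if there are indices $i$ and $k$ with $i+1<k\le n$ such that $a_i,a_{i+1},a_k$ are in the same relative order as $x,y,z$. $\pi$ avoids a pattern if it does not contain it. $\mathcal{S}_n(p,q)$ is the set of permutations of $[n]$ avoiding both $p$ and $q$. -}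

module Defs where

open import Data.Nat using (ℕ; suc; _<_)
open import Data.Fin using (Fin; toℕ)
open import Data.Vec using (Vec; lookup)
open import Data.List using (List; length)
open import Data.List.Relation.Unary.Unique.Propositional using (Unique)
open import Data.List.Membership.Propositional using (_∈_)
open import Data.Product using (_×_; ∃-syntax)
open import Function.Bundles using (_⇔_)
open import Relation.Binary.PropositionalEquality using (_≡_)

-- A word of length n over [n] (values 0..n-1, i.e. shifted by one;
-- this does not affect relative order).
Word : ℕ → Set
Word n = Vec (Fin n) n

IsPerm : ∀ {n} → Word n → Set
IsPerm {n} w = ∀ (i j : Fin n) → lookup w i ≡ lookup w j → i ≡ j

SameOrder : (a b c x y z : ℕ) → Set
SameOrder a b c x y z = ((a < b) ⇔ (x < y)) × ((a < c) ⇔ (x < z)) × ((b < c) ⇔ (y < z))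

ContainsX-YZ : ∀ {n} → (x y z : ℕ) → Word n → Set
ContainsX-YZ {n} x y z w =
  ∃[ i ] ∃[ j ] ∃[ k ] (toℕ {n} i < toℕ j × toℕ {n} k ≡ suc (toℕ {n} j)
    × SameOrder (toℕ (lookup w i)) (toℕ (lookup w j)) (toℕ (lookup w k)) x y z)

ContainsXY-Z : ∀ {n} → (x y z : ℕ) → Word n → Set
ContainsXY-Z {n} x y z w =
  ∃[ i ] ∃[ j ] ∃[ k ] (toℕ {n} j ≡ suc (toℕ {n} i) × toℕ {n} j < toℕ {n} k
    × SameOrder (toℕ (lookup w i)) (toℕ (lookup w j)) (toℕ (lookup w k)) x y z)

HasCard : {A : Set} → (A → Set) → ℕ → Set
HasCard {A} P k = ∃[ L ] (Unique L × (∀ (a : A) → (a ∈ L) ⇔ P a) × length L ≡ k)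

-- A permutation avoids 32-1 and 12-3 exactly when no a_{i+1} lies strictly between a_i and
-- a later letter a_k; so a_{i+1} is the largest of a_{i+1} … a_n after an ascent and the
-- smallest after a descent. Consequently the steps alternate, and the permutation is
-- determined by a_1 and the direction of its first step: the remaining values are taken
-- alternately from the top and from the bottom. The first step can go up unless a_1 = n and
-- down unless a_1 = 1, which gives 2(n-1) permutations. Reversal turns occurrences of 1-23
-- and 3-21 into occurrences of 32-1 and 12-3, so the other class has the same size.
module Submission where

open import Defs
open import Data.Bool using (Bool; true; false; not)
open import Data.Empty using (⊥-elim)
open import Data.Fin using (Fin; toℕ; fromℕ<; opposite; punchOut)
open import Data.Fin.Properties
  using (toℕ-injective; toℕ<n; toℕ-fromℕ<; opposite-prop; opposite-involutive; any?; injective⇒≤; punchOut-injective)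
  renaming (_≟_ to _≟ᶠ_)
open import Data.List using (List; []; _∷_; _++_; length; allFin; map; cartesianProductWith)
open import Data.List.Properties using (length-map; length-++; length-tabulate)
open import Data.List.Membership.Propositional using (_∈_)
open import Data.List.Membership.Propositional.Properties
  using (∈-map⁺; ∈-map⁻; ∈-allFin; ∈-cartesianProductWith⁺; ∈-cartesianProductWith⁻)
open import Data.List.Relation.Unary.All using ([]; _∷_)
open import Data.List.Relation.Unary.AllPairs using ([]; _∷_)
open import Data.List.Relation.Unary.Any using (here; there)
open import Data.List.Relation.Unary.Unique.Propositional using (Unique)
open import Data.List.Relation.Unary.Unique.Propositional.Properties
  using (map⁺; allFin⁺; cartesianProductWith⁺)
open import Data.Nat using (ℕ; zero; suc; _+_; _*_; _∸_; _≤_; _<_; z≤n; s≤s; z<s; s<s; _≟_; _<?_)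
open import Data.Nat.Induction using (<-rec)
open import Data.Nat.Properties
  using ( <-cmp; <-asym; <-irrefl; <-trans; ≤-refl; ≤-trans; <-≤-trans; ≤-<-trans; ≤-pred; n<1+n
        ; ≮⇒≥; <⇒≱; ≤∧≢⇒<
        ; <⇒≢; suc-injective; 1+n≰n; ∸-monoʳ-<; +-∸-assoc)
open import Data.Product using (_×_; _,_; proj₁; proj₂; ∃-syntax; ∃₂)
open import Data.Vec using (Vec; []; _∷_; lookup; tabulate)
open import Data.Vec.Properties using (lookup∘tabulate; tabulate∘lookup; tabulate-cong)
open import Function using (_∘_; id; const)
open import Function.Bundles using (_⇔_; mk⇔; Equivalence)
open import Function.Consequences.Propositional using (inverseʳ⇒injective; strictlyInverseʳ⇒inverseʳ)
open import Function.Definitions using (Injective)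
open import Relation.Binary using (tri<; tri≈; tri>)
open import Relation.Binary.PropositionalEquality
  using (_≡_; _≢_; refl; sym; trans; cong; cong₂; subst; subst₂; module ≡-Reasoning)
open import Relation.Nullary using (¬_; yes; no; contradiction)
open import Relation.Nullary.Decidable using (decidable-stable)

open ≡-Reasoning

Avoids1-23∧3-21 : ∀ {N} → Word N → Set
Avoids1-23∧3-21 w = IsPerm w × ¬ ContainsX-YZ 1 2 3 w × ¬ ContainsX-YZ 3 2 1 w

Avoids32-1∧12-3 : ∀ {N} → Word N → Set
Avoids32-1∧12-3 w = IsPerm w × ¬ ContainsXY-Z 3 2 1 w × ¬ ContainsXY-Z 1 2 3 w

involutive⇒injective : ∀ {A : Set} {f : A → A} → (∀ a → f (f a) ≡ a) → Injective _≡_ _≡_ f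
involutive⇒injective {f = f} invol = inverseʳ⇒injective {f⁻¹ = f} f (strictlyInverseʳ⇒inverseʳ f invol)

HasCard-involution : ∀ {A : Set} {P Q : A → Set} {k} (f : A → A) → (∀ a → f (f a) ≡ a) →
                     (∀ a → P a → Q (f a)) → (∀ a → Q a → P (f a)) → HasCard P k → HasCard Q k
HasCard-involution {P = P} {Q} f invol P⇒Q∘f Q⇒P∘f (L , L-unique , L-enumerates , L-length) =
  map f L , map⁺ (involutive⇒injective invol) L-unique , enumerates , trans (length-map f L) L-length
  where
  enumerates : ∀ a → (a ∈ map f L) ⇔ Q a
  enumerates a = mk⇔ to from
    where
    to : a ∈ map f L → Q a
    to a∈fL with b , b∈L , a≡fb ← ∈-map⁻ f a∈fL =
      subst Q (sym a≡fb) (P⇒Q∘f b (Equivalence.to (L-enumerates b) b∈L))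
    from : Q a → a ∈ map f L
    from Qa = subst (_∈ map f L) (invol a) (∈-map⁺ f (Equivalence.from (L-enumerates (f a)) (Q⇒P∘f a Qa)))

length-cartesianProductWith : ∀ {A B C : Set} (f : A → B → C) (xs : List A) (ys : List B) →
                              length (cartesianProductWith f xs ys) ≡ length xs * length ys
length-cartesianProductWith f []       ys = refl
length-cartesianProductWith f (x ∷ xs) ys = begin
  length (map (f x) ys ++ cartesianProductWith f xs ys)          ≡⟨ length-++ (map (f x) ys) ⟩
  length (map (f x) ys) + length (cartesianProductWith f xs ys)  ≡⟨ cong₂ _+_ (length-map (f x) ys)
                                                                                 (length-cartesianProductWith f xs ys) ⟩
  length ys + length xs * length ys                               ∎

injective⇒surjective : ∀ {n} {f : Fin n → Fin n} → Injective _≡_ _≡_ f → ∀ v → ∃[ i ] f i ≡ v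
injective⇒surjective {suc n} {f} f-injective v with any? (λ i → f i ≟ᶠ v)
... | yes hit = hit
... | no miss = contradiction (injective⇒≤ punchOut∘f-injective) 1+n≰n
  where
  v≢f : ∀ i → v ≢ f i
  v≢f i v≡fi = miss (i , sym v≡fi)
  punchOut∘f-injective : Injective _≡_ _≡_ (λ i → punchOut (v≢f i))
  punchOut∘f-injective eq = f-injective (punchOut-injective (v≢f _) (v≢f _) eq)

-- Positions past the end read as 0.
at : ∀ {m n} → Vec (Fin n) m → ℕ → ℕ
at []      _       = 0
at (x ∷ w) zero    = toℕ x
at (x ∷ w) (suc i) = at w i

at-lookup : ∀ {m n} (w : Vec (Fin n) m) (i : Fin m) → at w (toℕ i) ≡ toℕ (lookup w i)
at-lookup (x ∷ w) Fin.zero    = refl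
at-lookup (x ∷ w) (Fin.suc i) = at-lookup w i

at-fromℕ< : ∀ {m n} (w : Vec (Fin n) m) {i} (i<m : i < m) → at w i ≡ toℕ (lookup w (fromℕ< i<m))
at-fromℕ< w i<m = trans (cong (at w) (sym (toℕ-fromℕ< i<m))) (at-lookup w (fromℕ< i<m))

at-< : ∀ {m n} (w : Vec (Fin n) m) {i} → i < m → at w i < n
at-< (x ∷ w) {zero}  _         = toℕ<n x
at-< (x ∷ w) {suc i} (s<s i<m) = at-< w i<m

at-ext : ∀ {m n} (w v : Vec (Fin n) m) → (∀ {i} → i < m → at w i ≡ at v i) → w ≡ v
at-ext []      []      _      = refl
at-ext (x ∷ w) (y ∷ v) w≗v = cong₂ _∷_ (toℕ-injective (w≗v z<s)) (at-ext w v (w≗v ∘ s<s))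

fromFun : ∀ {n} m (g : ℕ → ℕ) → (∀ {i} → i < m → g i < n) → Vec (Fin n) m
fromFun zero    g g<n = []
fromFun (suc m) g g<n = fromℕ< (g<n z<s) ∷ fromFun m (g ∘ suc) (g<n ∘ s<s)

at-fromFun : ∀ {m n} {g : ℕ → ℕ} (g<n : ∀ {i} → i < m → g i < n) {i} → i < m → at (fromFun m g g<n) i ≡ g i
at-fromFun {suc m} g<n {zero}  _         = toℕ-fromℕ< (g<n z<s)
at-fromFun {suc m} g<n {suc i} (s<s i<m) = at-fromFun (g<n ∘ s<s) i<m

InjectiveBelow : ℕ → (ℕ → ℕ) → Set
InjectiveBelow N g = ∀ {i j} → i < N → j < N → g i ≡ g j → i ≡ j

at-injective : ∀ {N} (w : Word N) → IsPerm w → InjectiveBelow N (at w)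
at-injective w w-perm {i} {j} i<N j<N wi≡wj = begin
  i                  ≡⟨ toℕ-fromℕ< i<N ⟨
  toℕ (fromℕ< i<N)   ≡⟨ cong toℕ (w-perm _ _ (toℕ-injective same-letter)) ⟩
  toℕ (fromℕ< j<N)   ≡⟨ toℕ-fromℕ< j<N ⟩
  j                  ∎
  where
  same-letter : toℕ (lookup w (fromℕ< i<N)) ≡ toℕ (lookup w (fromℕ< j<N))
  same-letter = trans (sym (at-fromℕ< w i<N)) (trans wi≡wj (at-fromℕ< w j<N))

at-surjective : ∀ {N} (w : Word N) → IsPerm w → ∀ {v} → v < N → ∃[ i ] i < N × at w i ≡ v
at-surjective w w-perm {v} v<N with i , wi≡v ← injective⇒surjective (w-perm _ _) (fromℕ< v<N) =
  toℕ i , toℕ<n i , trans (at-lookup w i) (trans (cong toℕ wi≡v) (toℕ-fromℕ< v<N))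

fromFun-perm : ∀ {N} {g : ℕ → ℕ} (g<N : ∀ {i} → i < N → g i < N) → InjectiveBelow N g → IsPerm (fromFun N g g<N)
fromFun-perm {N} {g} g<N g-injective i j wi≡wj =
  toℕ-injective (g-injective (toℕ<n i) (toℕ<n j) (begin
    g (toℕ i)           ≡⟨ at-fromFun g<N (toℕ<n i) ⟨
    at w (toℕ i)        ≡⟨ at-lookup w i ⟩
    toℕ (lookup w i)    ≡⟨ cong toℕ wi≡wj ⟩
    toℕ (lookup w j)    ≡⟨ at-lookup w j ⟨
    at w (toℕ j)        ≡⟨ at-fromFun g<N (toℕ<n j) ⟩
    g (toℕ j)           ∎))
  where
  w : Word N
  w = fromFun N g g<N

sameOrder-cong : ∀ {a b c a′ b′ c′ x y z} → a ≡ a′ → b ≡ b′ → c ≡ c′ →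
                 SameOrder a b c x y z → SameOrder a′ b′ c′ x y z
sameOrder-cong refl refl refl = id

sameOrder-123 : ∀ {a b c} → a < b → b < c → SameOrder a b c 1 2 3
sameOrder-123 a<b b<c =
  mk⇔ (const (s<s z<s)) (const a<b) ,
  mk⇔ (const (s<s z<s)) (const (<-trans a<b b<c)) ,
  mk⇔ (const (s<s (s<s z<s))) (const b<c)

sameOrder-123⁻ : ∀ {a b c} → SameOrder a b c 1 2 3 → a < b × b < c
sameOrder-123⁻ (a<b⇔1<2 , _ , b<c⇔2<3) = Equivalence.from a<b⇔1<2 (s<s z<s) , Equivalence.from b<c⇔2<3 (s<s (s<s z<s))

sameOrder-321 : ∀ {a b c} → c < b → b < a → SameOrder a b c 3 2 1
sameOrder-321 c<b b<a =
  mk⇔ (λ a<b → contradiction b<a (<-asym a<b)) (λ 3<2 → contradiction 3<2 (<-asym (s<s (s<s z<s)))) ,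
  mk⇔ (λ a<c → contradiction (<-trans c<b b<a) (<-asym a<c)) (λ 3<1 → contradiction 3<1 (<-asym (s<s z<s))) ,
  mk⇔ (λ b<c → contradiction c<b (<-asym b<c)) (λ 2<1 → contradiction 2<1 (<-asym (s<s z<s)))

sameOrder-321⁻ : ∀ {a b c} → SameOrder a b c 3 2 1 → b ≤ a × c ≤ b
sameOrder-321⁻ (a<b⇔3<2 , _ , b<c⇔2<1) =
  ≮⇒≥ (<-asym (s<s (s<s z<s)) ∘ Equivalence.to a<b⇔3<2) ,
  ≮⇒≥ (<-asym (s<s z<s) ∘ Equivalence.to b<c⇔2<1)

containsXY-Z⁺ : ∀ {N x y z} (w : Word N) {i k} → suc i < k → k < N →
                SameOrder (at w i) (at w (suc i)) (at w k) x y z → ContainsXY-Z x y z w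
containsXY-Z⁺ {N} w {i} {k} 1+i<k k<N ordered =
  fromℕ< i<N , fromℕ< 1+i<N , fromℕ< k<N ,
  trans (toℕ-fromℕ< 1+i<N) (cong suc (sym (toℕ-fromℕ< i<N))) ,
  subst₂ _<_ (sym (toℕ-fromℕ< 1+i<N)) (sym (toℕ-fromℕ< k<N)) 1+i<k ,
  sameOrder-cong (at-fromℕ< w i<N) (at-fromℕ< w 1+i<N) (at-fromℕ< w k<N) ordered
  where
  1+i<N : suc i < N
  1+i<N = <-trans 1+i<k k<N
  i<N : i < N
  i<N = <-trans (n<1+n i) 1+i<N

containsXY-Z⁻ : ∀ {N x y z} (w : Word N) → ContainsXY-Z x y z w →
                ∃₂ λ i k → suc i < k × k < N × SameOrder (at w i) (at w (suc i)) (at w k) x y z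
containsXY-Z⁻ w (i , j , k , j≡1+i , j<k , ordered) =
  toℕ i , toℕ k , subst (_< toℕ k) j≡1+i j<k , toℕ<n k ,
  sameOrder-cong (sym (at-lookup w i)) (trans (sym (at-lookup w j)) (cong (at w) j≡1+i)) (sym (at-lookup w k)) ordered

SameSideOf : ℕ → ℕ → ℕ → Set
SameSideOf y x z = (x < y → z < y) × (y < x → y < z)

SuffixExtremal : ℕ → (ℕ → ℕ) → Set
SuffixExtremal N g = ∀ {i k} → suc i < k → k < N → SameSideOf (g (suc i)) (g i) (g k)

SuffixExtremal-cong : ∀ {N g h} → (∀ {i} → i < N → g i ≡ h i) → SuffixExtremal N g → SuffixExtremal N h
SuffixExtremal-cong g≗h g-extremal {i} {k} 1+i<k k<N
  rewrite sym (g≗h (<-trans (n<1+n i) (<-trans 1+i<k k<N)))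
        | sym (g≗h (<-trans 1+i<k k<N))
        | sym (g≗h k<N)
  = g-extremal 1+i<k k<N

avoids32-1∧12-3⇒suffixExtremal : ∀ {N} (w : Word N) → Avoids32-1∧12-3 w → SuffixExtremal N (at w)
avoids32-1∧12-3⇒suffixExtremal w (w-perm , no32-1 , no12-3) {i} {k} 1+i<k k<N =
  (λ ascent → decidable-stable (at w k <? at w (suc i)) λ k≮1+i →
     no12-3 (containsXY-Z⁺ w 1+i<k k<N (sameOrder-123 ascent (above k≮1+i)))) ,
  (λ descent → decidable-stable (at w (suc i) <? at w k) λ 1+i≮k →
     no32-1 (containsXY-Z⁺ w 1+i<k k<N (sameOrder-321 (below 1+i≮k) descent)))
  where
  1+i≢k : at w (suc i) ≢ at w k
  1+i≢k = <⇒≢ 1+i<k ∘ at-injective w w-perm (<-trans 1+i<k k<N) k<N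
  above : ¬ at w k < at w (suc i) → at w (suc i) < at w k
  above k≮1+i = ≤∧≢⇒< (≮⇒≥ k≮1+i) 1+i≢k
  below : ¬ at w (suc i) < at w k → at w k < at w (suc i)
  below 1+i≮k = ≤∧≢⇒< (≮⇒≥ 1+i≮k) (1+i≢k ∘ sym)

suffixExtremal⇒avoids32-1∧12-3 : ∀ {N} (w : Word N) → IsPerm w → SuffixExtremal N (at w) → Avoids32-1∧12-3 w
suffixExtremal⇒avoids32-1∧12-3 w w-perm w-extremal = w-perm , no32-1 , no12-3
  where
  no32-1 : ¬ ContainsXY-Z 3 2 1 w
  no32-1 occurrence with i , k , 1+i<k , k<N , ordered ← containsXY-Z⁻ w occurrence =
    <⇒≱ (proj₂ (w-extremal 1+i<k k<N) descent) k≤1+i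
    where
    i≢1+i : at w i ≢ at w (suc i)
    i≢1+i = <⇒≢ (n<1+n i) ∘ at-injective w w-perm (<-trans (n<1+n i) (<-trans 1+i<k k<N)) (<-trans 1+i<k k<N)
    descent : at w (suc i) < at w i
    descent = ≤∧≢⇒< (proj₁ (sameOrder-321⁻ ordered)) (i≢1+i ∘ sym)
    k≤1+i : at w k ≤ at w (suc i)
    k≤1+i = proj₂ (sameOrder-321⁻ ordered)
  no12-3 : ¬ ContainsXY-Z 1 2 3 w
  no12-3 occurrence with i , k , 1+i<k , k<N , ordered ← containsXY-Z⁻ w occurrence
    with ascent , 1+i<k′ ← sameOrder-123⁻ ordered =
    <-asym (proj₁ (w-extremal 1+i<k k<N) ascent) 1+i<k′

Beyond : Bool → ℕ → ℕ → Set
Beyond true  x y = y < x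
Beyond false x y = x < y

Beyond-irrefl : ∀ d {x} → ¬ Beyond d x x
Beyond-irrefl true  = <-irrefl refl
Beyond-irrefl false = <-irrefl refl

Beyond-asym : ∀ d {x y} → Beyond d x y → ¬ Beyond d y x
Beyond-asym true  = <-asym
Beyond-asym false = <-asym

Beyond-flip : ∀ d {x y} → Beyond d x y → Beyond (not d) y x
Beyond-flip true  = id
Beyond-flip false = id

Beyond-functional : ∀ d d′ {x y} → Beyond d x y → Beyond d′ x y → d ≡ d′
Beyond-functional true  true  _   _   = refl
Beyond-functional true  false y<x x<y = contradiction x<y (<-asym y<x)
Beyond-functional false true  x<y y<x = contradiction x<y (<-asym y<x)
Beyond-functional false false _   _   = refl

Beyond-mono : ∀ d {f : ℕ → ℕ} → (∀ {a b} → a < b → f a < f b) →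
              ∀ {x y} → Beyond d x y → Beyond d (f x) (f y)
Beyond-mono true  f-mono = f-mono
Beyond-mono false f-mono = f-mono

sameSide⇒Beyond : ∀ d {x y z} → Beyond d y x → SameSideOf y x z → Beyond d y z
sameSide⇒Beyond true  x<y (x<y⇒z<y , _) = x<y⇒z<y x<y
sameSide⇒Beyond false y<x (_ , y<x⇒y<z) = y<x⇒y<z y<x

Beyond⇒sameSide : ∀ d {x y z} → Beyond d y x → Beyond d y z → SameSideOf y x z
Beyond⇒sameSide true  x<y z<y = const z<y , λ y<x → contradiction x<y (<-asym y<x)
Beyond⇒sameSide false y<x y<z = (λ x<y → contradiction y<x (<-asym x<y)) , const y<z

alternate : Bool → ℕ → Bool
alternate d zero    = d
alternate d (suc k) = not (alternate d k)

alternate-not : ∀ d k → alternate (not d) k ≡ not (alternate d k)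
alternate-not d zero    = refl
alternate-not d (suc k) = cong not (alternate-not d k)

-- ℕ-valued Data.Fin.punchIn: skip r enumerates ℕ ∖ {r} in increasing order.
skip : ℕ → ℕ → ℕ
skip zero    v       = suc v
skip (suc r) zero    = zero
skip (suc r) (suc v) = suc (skip r v)

skip-≢ : ∀ r v → skip r v ≢ r
skip-≢ zero    v       ()
skip-≢ (suc r) zero    ()
skip-≢ (suc r) (suc v) eq = skip-≢ r v (suc-injective eq)

skip-≤ : ∀ r v → skip r v ≤ suc v
skip-≤ zero    v       = ≤-refl
skip-≤ (suc r) zero    = z≤n
skip-≤ (suc r) (suc v) = s≤s (skip-≤ r v)

skip-> : ∀ {r v} → r ≤ v → r < skip r v
skip-> {zero}  {v}     _         = z<s
skip-> {suc r} {suc v} (s≤s r≤v) = s<s (skip-> r≤v)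

skip-mono : ∀ r {u v} → u < v → skip r u < skip r v
skip-mono zero    u<v             = s<s u<v
skip-mono (suc r) {zero}  {suc v} _         = z<s
skip-mono (suc r) {suc u} {suc v} (s<s u<v) = s<s (skip-mono r u<v)

skip-injective : ∀ r {u v} → skip r u ≡ skip r v → u ≡ v
skip-injective zero    eq = suc-injective eq
skip-injective (suc r) {zero}  {zero}  _  = refl
skip-injective (suc r) {suc u} {suc v} eq = cong suc (skip-injective r (suc-injective eq))

-- zigzag true M = M-1, 0, M-2, 1, … and zigzag false M = 0, M-1, 1, M-2, …,
-- each running through 0 … M-1.
zigzag : Bool → ℕ → ℕ → ℕ
zigzag _     zero    _       = 0
zigzag true  (suc M) zero    = M
zigzag true  (suc M) (suc k) = zigzag false M k
zigzag false (suc M) zero    = 0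
zigzag false (suc M) (suc k) = suc (zigzag true M k)

zigzag-< : ∀ d {M k} → k < M → zigzag d M k < M
zigzag-< true  {suc M} {zero}  _         = n<1+n M
zigzag-< true  {suc M} {suc k} (s<s k<M) = <-trans (zigzag-< false k<M) (n<1+n M)
zigzag-< false {suc M} {zero}  _         = z<s
zigzag-< false {suc M} {suc k} (s<s k<M) = s<s (zigzag-< true k<M)

zigzag-beyond : ∀ d {M k l} → k < l → l < M → Beyond (alternate d k) (zigzag d M k) (zigzag d M l)
zigzag-beyond true  {suc M} {zero}  {suc l} _ (s<s l<M) = zigzag-< false l<M
zigzag-beyond false {suc M} {zero}  {suc l} _ _         = z<s
zigzag-beyond true  {suc M} {suc k} {suc l} (s<s k<l) (s<s l<M) =
  subst (λ d → Beyond d (zigzag false M k) (zigzag false M l)) (alternate-not true k) (zigzag-beyond false k<l l<M)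
zigzag-beyond false {suc M} {suc k} {suc l} (s<s k<l) (s<s l<M) =
  Beyond-mono (not (alternate false k)) s<s
    (subst (λ d → Beyond d (zigzag true M k) (zigzag true M l)) (alternate-not false k) (zigzag-beyond true k<l l<M))

zigzag-injective : ∀ d {M k l} → k < M → l < M → zigzag d M k ≡ zigzag d M l → k ≡ l
zigzag-injective d {k = k} {l} k<M l<M eq with <-cmp k l
... | tri< k<l _ _ = contradiction (subst (Beyond _ _) (sym eq) (zigzag-beyond d k<l l<M)) (Beyond-irrefl _)
... | tri≈ _ k≡l _ = k≡l
... | tri> _ _ l<k = contradiction (subst (Beyond _ _) eq (zigzag-beyond d l<k k<M)) (Beyond-irrefl _)

-- In both directions s ranges over 0 … M-1: an upward first step needs a_1 ≠ M, a
-- downward one needs a_1 ≠ 0.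
first : Bool → ℕ → ℕ
first true  s = s
first false s = suc s

first-injective : ∀ d {s t} → first d s ≡ first d t → s ≡ t
first-injective true  eq = eq
first-injective false eq = suc-injective eq

first-surjective : ∀ d {M x y} → Beyond d y x → x < suc M → y < suc M → ∃[ s ] s < M × first d s ≡ x
first-surjective true  x<y _ y<1+M = _ , <-≤-trans x<y (≤-pred y<1+M) , refl
first-surjective false {x = suc s} _ (s<s s<M) _ = s , s<M , refl

extremalSeq : ℕ → Bool → ℕ → ℕ → ℕ
extremalSeq M d s zero    = first d s
extremalSeq M d s (suc k) = skip (first d s) (zigzag d M k)

extremalSeq-firstStep : ∀ d {M s} → s < M → Beyond d (extremalSeq M d s 1) (extremalSeq M d s 0)
extremalSeq-firstStep true  {suc M} (s<s s≤M) = skip-> s≤M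
extremalSeq-firstStep false {suc M} _         = z<s

module _ {M : ℕ} (d : Bool) {s : ℕ} where

  private
    g : ℕ → ℕ
    g = extremalSeq M d s

  extremalSeq-< : s < M → ∀ {i} → i < suc M → g i < suc M
  extremalSeq-< s<M {zero}  _         = first-< d
    where
    first-< : ∀ e → first e s < suc M
    first-< true  = <-trans s<M (n<1+n M)
    first-< false = s<s s<M
  extremalSeq-< s<M {suc i} (s<s i<M) = s≤s (≤-trans (skip-≤ (first d s) _) (zigzag-< d i<M))

  extremalSeq-injective : InjectiveBelow (suc M) g
  extremalSeq-injective {zero}  {zero}  _ _ _  = refl
  extremalSeq-injective {zero}  {suc j} _ _ eq = contradiction (sym eq) (skip-≢ (first d s) _)
  extremalSeq-injective {suc i} {zero}  _ _ eq = contradiction eq (skip-≢ (first d s) _)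
  extremalSeq-injective {suc i} {suc j} (s<s i<M) (s<s j<M) eq =
    cong suc (zigzag-injective d i<M j<M (skip-injective (first d s) eq))

  extremalSeq-step : s < M → ∀ {i} → suc i < suc M → Beyond (alternate d i) (g (suc i)) (g i)
  extremalSeq-step s<M {zero}  _           = extremalSeq-firstStep d s<M
  extremalSeq-step s<M {suc i} (s<s 1+i<M) =
    Beyond-flip (alternate d i) (Beyond-mono (alternate d i) (skip-mono (first d s)) (zigzag-beyond d (n<1+n i) 1+i<M))

  extremalSeq-beyondLater : ∀ {i k} → suc i < k → k < suc M → Beyond (alternate d i) (g (suc i)) (g k)
  extremalSeq-beyondLater {i} {suc k} (s<s i<k) (s<s k<M) =
    Beyond-mono (alternate d i) (skip-mono (first d s)) (zigzag-beyond d i<k k<M)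

  extremalSeq-suffixExtremal : s < M → SuffixExtremal (suc M) g
  extremalSeq-suffixExtremal s<M 1+i<k k<1+M =
    Beyond⇒sameSide _ (extremalSeq-step s<M (<-trans 1+i<k k<1+M)) (extremalSeq-beyondLater 1+i<k k<1+M)

extremalWord : ∀ {M} → Bool → Fin M → Word (suc M)
extremalWord {M} d s = fromFun (suc M) (extremalSeq M d (toℕ s)) (extremalSeq-< d (toℕ<n s))

module _ {M : ℕ} (d : Bool) (s : Fin M) where

  private
    w : Word (suc M)
    w = extremalWord d s
    at-w : ∀ {i} → i < suc M → at w i ≡ extremalSeq M d (toℕ s) i
    at-w = at-fromFun (extremalSeq-< d (toℕ<n s))
    1<1+M : 1 < suc M
    1<1+M = s<s (≤-<-trans z≤n (toℕ<n s))

  extremalWord-first : at w 0 ≡ first d (toℕ s)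
  extremalWord-first = at-w z<s

  extremalWord-firstStep : Beyond d (at w 1) (at w 0)
  extremalWord-firstStep = subst₂ (Beyond d) (sym (at-w 1<1+M)) (sym (at-w z<s)) (extremalSeq-firstStep d (toℕ<n s))

  extremalWord-perm : IsPerm w
  extremalWord-perm = fromFun-perm (extremalSeq-< d (toℕ<n s)) (extremalSeq-injective d)

  extremalWord-suffixExtremal : SuffixExtremal (suc M) (at w)
  extremalWord-suffixExtremal = SuffixExtremal-cong (sym ∘ at-w) (extremalSeq-suffixExtremal d (toℕ<n s))

  extremalWord-avoids : Avoids32-1∧12-3 w
  extremalWord-avoids = suffixExtremal⇒avoids32-1∧12-3 w extremalWord-perm extremalWord-suffixExtremal

extremalWord-injective₂ : ∀ {M} {d d′} {s s′ : Fin M} →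
                          extremalWord d s ≡ extremalWord d′ s′ → d ≡ d′ × s ≡ s′
extremalWord-injective₂ {d = d} {d′} {s} {s′} eq
  with refl ← Beyond-functional d d′ (extremalWord-firstStep d s)
                (subst (λ w → Beyond d′ (at w 1) (at w 0)) (sym eq) (extremalWord-firstStep d′ s′)) =
  refl , toℕ-injective (first-injective d (begin
    first d (toℕ s)            ≡⟨ extremalWord-first d s ⟨
    at (extremalWord d s) 0    ≡⟨ cong (λ w → at w 0) eq ⟩
    at (extremalWord d s′) 0   ≡⟨ extremalWord-first d s′ ⟩
    first d (toℕ s′)           ∎))

steps-alternate : ∀ {N d} (w : Word N) → SuffixExtremal N (at w) → Beyond d (at w 1) (at w 0) →
                  ∀ {i} → suc i < N → Beyond (alternate d i) (at w (suc i)) (at w i)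
steps-alternate w w-extremal first-step {zero}  _       = first-step
steps-alternate {d = d} w w-extremal first-step {suc i} 2+i<N =
  Beyond-flip (alternate d i)
    (sameSide⇒Beyond (alternate d i) (steps-alternate w w-extremal first-step (<-trans (n<1+n (suc i)) 2+i<N))
                     (w-extremal (n<1+n (suc i)) 2+i<N))

-- The letter v_{i+1} must occur in w after position i+1, so extremality of w puts w_{i+1}
-- beyond it.
first-difference-beyond : ∀ {N δ i} (w v : Word N) → IsPerm w → IsPerm v → SuffixExtremal N (at w) → suc i < N →
                          (∀ {j} → j ≤ i → at w j ≡ at v j) → at w (suc i) ≢ at v (suc i) →
                          Beyond δ (at w (suc i)) (at w i) → Beyond δ (at w (suc i)) (at v (suc i))
first-difference-beyond {δ = δ} {i} w v w-perm v-perm w-extremal 1+i<N agree differ step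
  with q , q<N , wq≡v1+i ← at-surjective w w-perm (at-< v 1+i<N) =
  subst (Beyond δ (at w (suc i))) wq≡v1+i (sameSide⇒Beyond δ step (w-extremal 1+i<q q<N))
  where
  1+i<q : suc i < q
  1+i<q with <-cmp q (suc i)
  ... | tri< q<1+i _ _ = contradiction (at-injective v v-perm q<N 1+i<N (trans (sym (agree (≤-pred q<1+i))) wq≡v1+i))
                                       (<⇒≢ q<1+i)
  ... | tri≈ _ refl _  = contradiction wq≡v1+i differ
  ... | tri> _ _ 1+i<q = 1+i<q

suffixExtremal-unique : ∀ {N d} {w v : Word N} → IsPerm w → IsPerm v →
                        SuffixExtremal N (at w) → SuffixExtremal N (at v) → at w 0 ≡ at v 0 →
                        Beyond d (at w 1) (at w 0) → Beyond d (at v 1) (at v 0) → w ≡ v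
suffixExtremal-unique {N} {d} {w} {v} w-perm v-perm w-extremal v-extremal same-first w-first v-first =
  at-ext w v (λ {i} → <-rec (λ i → i < N → at w i ≡ at v i) agree i)
  where
  agree : ∀ i → (∀ {j} → j < i → j < N → at w j ≡ at v j) → i < N → at w i ≡ at v i
  agree zero    _     _     = same-first
  agree (suc i) below 1+i<N with at w (suc i) ≟ at v (suc i)
  ... | yes eq     = eq
  ... | no  differ = ⊥-elim (
    Beyond-asym (alternate d i)
      (first-difference-beyond w v w-perm v-perm w-extremal 1+i<N prefix-agrees differ
         (steps-alternate w w-extremal w-first 1+i<N))
      (first-difference-beyond v w v-perm w-perm v-extremal 1+i<N (sym ∘ prefix-agrees) (differ ∘ sym)
         (steps-alternate v v-extremal v-first 1+i<N)))
    where
    prefix-agrees : ∀ {j} → j ≤ i → at w j ≡ at v j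
    prefix-agrees j≤i = below (s≤s j≤i) (≤-<-trans j≤i (<-trans (n<1+n i) 1+i<N))

module _ {m : ℕ} (w : Word (2 + m)) (w-perm : IsPerm w) (w-extremal : SuffixExtremal (2 + m) (at w)) where

  first-step-direction : ∃[ d ] Beyond d (at w 1) (at w 0)
  first-step-direction with <-cmp (at w 0) (at w 1)
  ... | tri< up _ _   = true , up
  ... | tri≈ _ eq _   = contradiction (at-injective w w-perm z<s (s<s z<s) eq) (λ ())
  ... | tri> _ _ down = false , down

  suffixExtremal⇒extremalWord : ∃₂ λ d s → w ≡ extremalWord d s
  suffixExtremal⇒extremalWord
    with d , step ← first-step-direction
    with s , s<1+m , first≡w0 ← first-surjective d step (at-< w z<s) (at-< w (s<s z<s)) =
    d , fromℕ< s<1+m ,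
    suffixExtremal-unique w-perm (extremalWord-perm d _) w-extremal (extremalWord-suffixExtremal d _)
      same-first step (extremalWord-firstStep d _)
    where
    same-first : at w 0 ≡ at (extremalWord d (fromℕ< s<1+m)) 0
    same-first = begin
      at w 0                                     ≡⟨ first≡w0 ⟨
      first d s                                  ≡⟨ cong (first d) (toℕ-fromℕ< s<1+m) ⟨
      first d (toℕ (fromℕ< s<1+m))               ≡⟨ extremalWord-first d _ ⟨
      at (extremalWord d (fromℕ< s<1+m)) 0       ∎

directions : List Bool
directions = true ∷ false ∷ []

directions-unique : Unique directions
directions-unique = ((λ ()) ∷ []) ∷ [] ∷ []

∈-directions : ∀ d → d ∈ directions
∈-directions true  = here refl
∈-directions false = there (here refl)

extremalWords : ∀ m → List (Word (2 + m))
extremalWords m = cartesianProductWith extremalWord directions (allFin (suc m))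

extremalWord∈extremalWords : ∀ {m} d (s : Fin (suc m)) → extremalWord d s ∈ extremalWords m
extremalWord∈extremalWords {m} d s =
  ∈-cartesianProductWith⁺ extremalWord {xs = directions} {ys = allFin (suc m)} (∈-directions d) (∈-allFin s)

avoiders32-1∧12-3-count : ∀ m → HasCard (Avoids32-1∧12-3 {2 + m}) (2 * suc m)
avoiders32-1∧12-3-count m = extremalWords m , unique , enumerates , size
  where
  unique : Unique (extremalWords m)
  unique = cartesianProductWith⁺ extremalWord extremalWord-injective₂ directions-unique (allFin⁺ (suc m))
  enumerates : ∀ w → (w ∈ extremalWords m) ⇔ Avoids32-1∧12-3 w
  enumerates w = mk⇔ to from
    where
    to : w ∈ extremalWords m → Avoids32-1∧12-3 w
    to w∈ =
      let d , s , _ , _ , w≡ = ∈-cartesianProductWith⁻ extremalWord directions (allFin (suc m)) w∈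
      in subst Avoids32-1∧12-3 (sym w≡) (extremalWord-avoids d s)
    from : Avoids32-1∧12-3 w → w ∈ extremalWords m
    from avoids@(w-perm , _) =
      let d , s , w≡ = suffixExtremal⇒extremalWord w w-perm (avoids32-1∧12-3⇒suffixExtremal w avoids)
      in subst (_∈ extremalWords m) (sym w≡) (extremalWord∈extremalWords d s)
  size : length (extremalWords m) ≡ 2 * suc m
  size = trans (length-cartesianProductWith extremalWord directions (allFin (suc m)))
               (cong (2 *_) (length-tabulate {n = suc m} id))

reverseWord : ∀ {N} → Word N → Word N
reverseWord w = tabulate (lookup w ∘ opposite)

lookup-reverseWord : ∀ {N} (w : Word N) i → lookup (reverseWord w) i ≡ lookup w (opposite i)
lookup-reverseWord w = lookup∘tabulate (lookup w ∘ opposite)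

reverseWord-involutive : ∀ {N} (w : Word N) → reverseWord (reverseWord w) ≡ w
reverseWord-involutive w = begin
  tabulate (lookup (reverseWord w) ∘ opposite)  ≡⟨ tabulate-cong (λ i → trans (lookup-reverseWord w (opposite i))
                                                                            (cong (lookup w) (opposite-involutive i))) ⟩
  tabulate (lookup w)                           ≡⟨ tabulate∘lookup w ⟩
  w                                             ∎

reverseWord-perm : ∀ {N} (w : Word N) → IsPerm w → IsPerm (reverseWord w)
reverseWord-perm w w-perm i j eq =
  involutive⇒injective opposite-involutive
    (w-perm _ _ (trans (sym (lookup-reverseWord w i)) (trans eq (lookup-reverseWord w j))))

opposite-< : ∀ {N} {i j : Fin N} → toℕ i < toℕ j → toℕ (opposite j) < toℕ (opposite i)
opposite-< {N} {i} {j} i<j =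
  subst₂ _<_ (sym (opposite-prop j)) (sym (opposite-prop i)) (∸-monoʳ-< (s<s i<j) (toℕ<n j))

opposite-adjacent : ∀ {N} {i j : Fin N} → toℕ j ≡ suc (toℕ i) → toℕ (opposite i) ≡ suc (toℕ (opposite j))
opposite-adjacent {N} {i} {j} j≡1+i = begin
  toℕ (opposite i)             ≡⟨ opposite-prop i ⟩
  N ∸ suc (toℕ i)              ≡⟨ +-∸-assoc 1 (subst (_< N) j≡1+i (toℕ<n j)) ⟩
  suc (N ∸ suc (suc (toℕ i)))  ≡⟨ cong (λ k → suc (N ∸ suc k)) j≡1+i ⟨
  suc (N ∸ suc (toℕ j))        ≡⟨ cong suc (opposite-prop j) ⟨
  suc (toℕ (opposite j))       ∎

Distinct : ℕ → ℕ → ℕ → Set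
Distinct a b c = a ≢ b × a ≢ c × b ≢ c

⇔-flip : ∀ {a b x y} → a ≢ b → x ≢ y → (a < b ⇔ x < y) → (b < a ⇔ y < x)
⇔-flip a≢b x≢y a<b⇔x<y =
  mk⇔ (λ b<a → ≤∧≢⇒< (≮⇒≥ (<-asym b<a ∘ Equivalence.from a<b⇔x<y)) (x≢y ∘ sym))
      (λ y<x → ≤∧≢⇒< (≮⇒≥ (<-asym y<x ∘ Equivalence.to a<b⇔x<y)) (a≢b ∘ sym))

sameOrder-reverse : ∀ {a b c x y z} → Distinct a b c → Distinct x y z →
                    SameOrder a b c x y z → SameOrder c b a z y x
sameOrder-reverse (a≢b , a≢c , b≢c) (x≢y , x≢z , y≢z) (ab , ac , bc) =
  ⇔-flip b≢c y≢z bc , ⇔-flip a≢c x≢z ac , ⇔-flip a≢b x≢y ab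

module _ {N} (v : Word N) (reversed-perm : IsPerm (reverseWord v)) {x y z} (xyz-distinct : Distinct x y z) where

  private
    letter : Fin N → ℕ
    letter i = toℕ (lookup (reverseWord v) i)

    letter≡ : ∀ i → letter i ≡ toℕ (lookup v (opposite i))
    letter≡ i = cong toℕ (lookup-reverseWord v i)

    letter-distinct : ∀ {i j} → toℕ i < toℕ j → letter i ≢ letter j
    letter-distinct i<j eq = <⇒≢ i<j (cong toℕ (reversed-perm _ _ (toℕ-injective eq)))

    reverse-occurrence : ∀ {i j k} → toℕ i < toℕ j → toℕ j < toℕ k →
                         SameOrder (letter i) (letter j) (letter k) x y z →
                         SameOrder (toℕ (lookup v (opposite k))) (toℕ (lookup v (opposite j)))
                                   (toℕ (lookup v (opposite i))) z y x
    reverse-occurrence {i} {j} {k} i<j j<k ordered =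
      sameOrder-cong (letter≡ k) (letter≡ j) (letter≡ i)
        (sameOrder-reverse (letter-distinct i<j , letter-distinct (<-trans i<j j<k) , letter-distinct j<k)
                           xyz-distinct ordered)

  reverse-containsX-YZ : ContainsX-YZ x y z (reverseWord v) → ContainsXY-Z z y x v
  reverse-containsX-YZ (i , j , k , i<j , k≡1+j , ordered) =
    opposite k , opposite j , opposite i , opposite-adjacent k≡1+j , opposite-< i<j ,
    reverse-occurrence i<j (subst (toℕ j <_) (sym k≡1+j) (n<1+n (toℕ j))) ordered

  reverse-containsXY-Z : ContainsXY-Z x y z (reverseWord v) → ContainsX-YZ z y x v
  reverse-containsXY-Z (i , j , k , j≡1+i , j<k , ordered) =
    opposite k , opposite j , opposite i , opposite-< j<k , opposite-adjacent j≡1+i ,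
    reverse-occurrence (subst (toℕ i <_) (sym j≡1+i) (n<1+n (toℕ i))) j<k ordered

123-distinct : Distinct 1 2 3
123-distinct = (λ ()) , (λ ()) , (λ ())

321-distinct : Distinct 3 2 1
321-distinct = (λ ()) , (λ ()) , (λ ())

reverse-avoids32-1∧12-3 : ∀ {N} (v : Word N) → Avoids32-1∧12-3 v → Avoids1-23∧3-21 (reverseWord v)
reverse-avoids32-1∧12-3 v (v-perm , no32-1 , no12-3) =
  reversed-perm ,
  no32-1 ∘ reverse-containsX-YZ v reversed-perm 123-distinct ,
  no12-3 ∘ reverse-containsX-YZ v reversed-perm 321-distinct
  where
  reversed-perm : IsPerm (reverseWord v)
  reversed-perm = reverseWord-perm v v-perm

reverse-avoids1-23∧3-21 : ∀ {N} (w : Word N) → Avoids1-23∧3-21 w → Avoids32-1∧12-3 (reverseWord w)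
reverse-avoids1-23∧3-21 w (w-perm , no1-23 , no3-21) =
  reversed-perm ,
  no1-23 ∘ reverse-containsXY-Z w reversed-perm 321-distinct ,
  no3-21 ∘ reverse-containsXY-Z w reversed-perm 123-distinct
  where
  reversed-perm : IsPerm (reverseWord w)
  reversed-perm = reverseWord-perm w w-perm

mainTheorem2 : ∀ (n : ℕ) → 2 ≤ n →
    HasCard {Word n} (λ w → IsPerm w × ¬ ContainsX-YZ 1 2 3 w × ¬ ContainsX-YZ 3 2 1 w) (2 * (n ∸ 1))
    × HasCard {Word n} (λ w → IsPerm w × ¬ ContainsXY-Z 3 2 1 w × ¬ ContainsXY-Z 1 2 3 w) (2 * (n ∸ 1))
mainTheorem2 (suc (suc m)) (s≤s (s≤s z≤n)) =
  HasCard-involution reverseWord reverseWord-involutive reverse-avoids32-1∧12-3 reverse-avoids1-23∧3-21 count ,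
  count
  where
  count : HasCard (Avoids32-1∧12-3 {2 + m}) (2 * suc m)
  count = avoiders32-1∧12-3-count m
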